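{- Let $r\geq 4$, let $Z_r$ be the rank-$r$ binary spike on $E=\{x_1,\dots,x_r,y_1,\dots,y_r,t\}$ with tip $t$, and let $X\subseteq E$ with $t\notin X$. Then for every $e\in X$, the $es$-splitting matroid $(Z_r)^e_X$ is not isomorphic to the spike $Z_{r+1}$.
   Context: $Z_r$ ($r\ge3$) is the vector matroid over $GF(2)$ of the $r\times(2r+1)$ matrix $[I_r\,|\,J_r-I_r\,|\,\mathbf 1]$ ($J_r$ the all-ones $r\times r$ matrix, $\mathbf 1$ the all-ones column), with columns labeled in order $x_1,\dots,x_r,y_1,\dots,y_r,t$; it is a spike with tip $t$ and legs $\{t,x_i,y_i\}$. $es$-splitting: for a binary matroid $M$ on $E$ represented over $GF(2)$ by a matrix $A$, a set $X\subseteq E$ and $e\in X$, let $A^e_X$ be obtained from $A$ by adjoining a new last row that is $1$ in the columns of elements of $X$ and $0$ elsewhere, and then adjoining two new columns $\alpha$ (zero except $1$ in the new last row) and $\gamma$ (the sum of the columns of $\alpha$ and $e$). $M^e_X$ is the vector matroid of $A^e_X$, on $E\cup\{\alpha,\gamma\}$. -}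

module Defs where

open import Data.Nat using (ℕ; zero; suc; _+_)
open import Data.Fin using (Fin; zero; suc; splitAt; _↑ʳ_; _↑ˡ_)
open import Data.Fin.Properties using (_≟_)
open import Data.Bool using (Bool; true; false; _xor_; _∧_; not)
open import Data.Sum using (_⊎_; inj₁; inj₂)
open import Data.Product using (Σ; ∃; _,_)
open import Function using (_∘_; _⇔_)
open import Function.Bundles using (Bijection; _⤖_)
open import Relation.Nullary using (¬_)
open import Relation.Nullary.Decidable using (⌊_⌋)
open import Relation.Binary.PropositionalEquality using (_≡_)

-- A matrix over GF(2) (Bool with xor/∧) with m rows and n columns;
-- the columns are the ground set elements Fin n.
Matrix : ℕ → ℕ → Set
Matrix m n = Fin m → Fin n → Bool

Subset : ℕ → Set
Subset n = Fin n → Bool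

xorSum : ∀ {n} → (Fin n → Bool) → Bool
xorSum {zero}  f = false
xorSum {suc n} f = f zero xor xorSum (f ∘ suc)

-- Independence in the vector matroid M[A] over GF(2): S is independent iff
-- no nonempty subset T ⊆ S has columns summing to the zero vector
-- (a GF(2)-linear combination is exactly a subset sum).
Indep : ∀ {m n} → Matrix m n → Subset n → Set
Indep {m} {n} A S =
  (T : Subset n) → (∀ j → T j ≡ true → S j ≡ true) → (∃ λ j → T j ≡ true) →
  ¬ (∀ (i : Fin m) → xorSum (λ j → T j ∧ A i j) ≡ false)

Isomorphic : ∀ {m n m' n'} → Matrix m n → Matrix m' n' → Set
Isomorphic {n = n} {n' = n'} A B =
  Σ (Fin n ⤖ Fin n') λ φ →
    ∀ (T : Subset n') → Indep B T ⇔ Indep A (T ∘ Bijection.to φ)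

-- The binary spike Z_r: the matrix [I_r | J_r - I_r | 1] with columns
-- x_1..x_r (indices 0..r-1), y_1..y_r (indices r..2r-1), t (index 2r).
Z : (r : ℕ) → Matrix r (r + r + 1)
Z r i j with splitAt (r + r) j
... | inj₂ _ = true
... | inj₁ k with splitAt r k
...   | inj₁ a = ⌊ a ≟ i ⌋
...   | inj₂ b = not ⌊ b ≟ i ⌋

tip : (r : ℕ) → Fin (r + r + 1)
tip r = (r + r) ↑ʳ zero

-- es-splitting A^e_X: new last row (index m) equal to the indicator of X,
-- new columns α (index n) and γ = α + e (index n+1).
split : ∀ {m n} → Matrix m n → Subset n → Fin n → Matrix (m + 1) (n + 2)
split {m} {n} A X e i j with splitAt m i | splitAt n j
... | inj₁ i' | inj₁ j'              = A i' j'
... | inj₂ _  | inj₁ j'              = X j'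
... | inj₁ i' | inj₂ zero            = false
... | inj₂ _  | inj₂ zero            = true
... | inj₁ i' | inj₂ (suc zero)      = A i' e
... | inj₂ _  | inj₂ (suc zero)      = not (X e)    -- γ = α + e (1 + X e)

module Submission where

-- In Z_{r+1} the tip lies on r + 1 triangles, the legs, which pairwise meet only in the tip; an
-- isomorphism would pull them back to such a family of triangles of M = (Z_r)^e_X covering α.
-- Since Z_r is simple, the only triangle of M through α is {α, e, γ}.  Hence α is not the hub of
-- the family (two legs would both be {α, e, γ}), and if α lies on a leg then the hub is e or γ.
-- But Z_r (r ≥ 4) has no triangle avoiding its tip t, and e ≠ t as e ∈ X ∌ t, so every other leg
-- would have to contain t, which two disjoint legs cannot both do.

open import Defs
open import Algebra.Bundles using (CommutativeMonoid; CommutativeRing)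
import Algebra.Properties.CommutativeSemigroup as CommutativeSemigroupProperties
open import Data.Bool using (Bool; true; false; _xor_; _∧_; _∨_; not)
open import Data.Bool.Properties
  using (xor-identityʳ; xor-same; xor-assoc; xor-inverseˡ; xor-inverseʳ; xor-comm; not-distribˡ-xor;
         ¬-not; not-¬; ∨-zeroʳ; ∨-commutativeMonoid; xor-∧-commutativeRing)
open import Data.Fin using (Fin; zero; suc; splitAt; _↑ʳ_; _↑ˡ_)
open import Data.Fin.Properties
  using (_≟_; any?; ¬∀⟶∃¬; injective⇒≤; ↑ˡ-injective; ↑ʳ-injective;
         splitAt-↑ˡ; splitAt-↑ʳ; splitAt⁻¹-↑ˡ; splitAt⁻¹-↑ʳ)
open import Data.Nat using (ℕ; zero; suc; _+_; _≤_; _<_; s≤s)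
open import Data.Nat.Properties using (<⇒≤; <⇒≱; m≤n⇒m≤1+n)
open import Data.Product using (∃; ∃₂; _×_; _,_; proj₁; proj₂; uncurry)
open import Data.Sum using (_⊎_; inj₁; inj₂; [_,_]′)
open import Data.Vec.Functional using ([]; _∷_)
open import Function using (_∘_; id; Injective)
open import Function.Bundles using (Inverse; Equivalence)
open import Function.Properties.Bijection using (Bijection⇒Inverse)
open import Relation.Nullary using (¬_; yes; no; does; contradiction)
open import Relation.Nullary.Decidable using (⌊_⌋; dec-true; dec-false; isYes≗does)
open import Relation.Binary.PropositionalEquality
  using (_≡_; _≢_; _≗_; refl; sym; trans; cong; cong₂; subst; module ≡-Reasoning)

private
  module Xor = CommutativeSemigroupProperties (CommutativeRing.+-commutativeSemigroup xor-∧-commutativeRing)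
  module Or = CommutativeSemigroupProperties (CommutativeMonoid.commutativeSemigroup ∨-commutativeMonoid)

  variable
    m n k r : ℕ

Nonzero : (Fin m → Bool) → Set
Nonzero v = ∃ λ i → v i ≡ true

infixr 5 _⊕_
infixr 6 _·_

_⊕_ : (Fin m → Bool) → (Fin m → Bool) → Fin m → Bool
(u ⊕ v) i = u i xor v i

_·_ : Bool → (Fin m → Bool) → Fin m → Bool
(s · v) i = s ∧ v i

column : Matrix m n → Fin n → Fin m → Bool
column A j i = A i j

nonzero-cong : {u v : Fin m → Bool} → u ≗ v → Nonzero u → Nonzero v
nonzero-cong u≗v (i , uᵢ) = i , trans (sym (u≗v i)) uᵢ

nonzero-flip : (f : Bool) {d : Fin m → Bool} → Nonzero d → (∃ λ i → d i ≡ false) →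
               Nonzero (λ i → f xor d i)
nonzero-flip false d≢0 _       = d≢0
nonzero-flip true  _   (i , dᵢ) = i , cong not dᵢ

LinIndep₃ : (u v w : Fin m → Bool) → Set
LinIndep₃ u v w = ∀ s₁ s₂ s₃ → s₁ ∨ s₂ ∨ s₃ ≡ true → Nonzero (s₁ · u ⊕ s₂ · v ⊕ s₃ · w)

linIndep₃ : {u v w : Fin m → Bool} →
            Nonzero u → Nonzero v → Nonzero w →
            Nonzero (u ⊕ v) → Nonzero (u ⊕ w) → Nonzero (v ⊕ w) → Nonzero (u ⊕ v ⊕ w) →
            LinIndep₃ u v w
linIndep₃ {u = u} {v} u≢0 v≢0 w≢0 uv≢0 uw≢0 vw≢0 uvw≢0 = λ where
  true  false false _ → nonzero-cong (λ i → sym (xor-identityʳ (u i))) u≢0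
  false true  false _ → nonzero-cong (λ i → sym (xor-identityʳ (v i))) v≢0
  false false true  _ → w≢0
  true  true  false _ → nonzero-cong (λ i → cong (u i xor_) (sym (xor-identityʳ (v i)))) uv≢0
  true  false true  _ → uw≢0
  false true  true  _ → vw≢0
  true  true  true  _ → uvw≢0

linIndep₃-cong : {u v w u′ v′ w′ : Fin m → Bool} → u ≗ u′ → v ≗ v′ → w ≗ w′ →
                 LinIndep₃ u v w → LinIndep₃ u′ v′ w′
linIndep₃-cong u≗ v≗ w≗ indep s₁ s₂ s₃ s≢0 = nonzero-cong
  (λ i → cong₂ _xor_ (cong (s₁ ∧_) (u≗ i)) (cong₂ _xor_ (cong (s₂ ∧_) (v≗ i)) (cong (s₃ ∧_) (w≗ i))))
  (indep s₁ s₂ s₃ s≢0)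

linIndep₃-restrict : {m′ : ℕ} (ρ : Fin m′ → Fin m) {u v w : Fin m → Bool} →
                     LinIndep₃ (u ∘ ρ) (v ∘ ρ) (w ∘ ρ) → LinIndep₃ u v w
linIndep₃-restrict ρ indep s₁ s₂ s₃ s≢0 with i , hit ← indep s₁ s₂ s₃ s≢0 = ρ i , hit

-- A vector vanishing on the rows ρ cannot be spanned by vectors that are independent there.
linIndep₃-adjoin : {m′ : ℕ} (ρ : Fin m′ → Fin m) {u v w : Fin m → Bool} →
                   (∀ i → u (ρ i) ≡ false) → Nonzero u →
                   Nonzero (v ∘ ρ) → Nonzero (w ∘ ρ) → Nonzero ((v ⊕ w) ∘ ρ) →
                   LinIndep₃ u v w
linIndep₃-adjoin ρ {u} u∘ρ≡0 u≢0 v≢0 w≢0 vw≢0 =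
  linIndep₃ u≢0 (lift v≢0) (lift w≢0) (beside v≢0) (beside w≢0) (lift vw≢0) (beside vw≢0)
  where
  lift : {x : Fin _ → Bool} → Nonzero (x ∘ ρ) → Nonzero x
  lift (i , xᵢ) = ρ i , xᵢ
  beside : {x : Fin _ → Bool} → Nonzero (x ∘ ρ) → Nonzero (u ⊕ x)
  beside (i , xᵢ) = ρ i , trans (cong (_xor _) (u∘ρ≡0 i)) xᵢ

erase : Fin n → (Fin n → Bool) → Fin n → Bool
erase a f j = not (does (j ≟ a)) ∧ f j

erase-≢ : {a j : Fin n} (f : Fin n → Bool) → j ≢ a → erase a f j ≡ f j
erase-≢ {a = a} {j} f j≢a = cong (λ d → not d ∧ f j) (dec-false (j ≟ a) j≢a)

xorSum-erase : (a : Fin n) (f : Fin n → Bool) → xorSum f ≡ f a xor xorSum (erase a f)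
xorSum-erase zero    f = refl
xorSum-erase (suc a) f = trans (cong (f zero xor_) (xorSum-erase a (f ∘ suc)))
                               (Xor.x∙yz≈y∙xz (f zero) (f (suc a)) _)

xorSum-zero : {f : Fin n → Bool} → (∀ j → f j ≡ false) → xorSum f ≡ false
xorSum-zero {n = zero}  f≡0 = refl
xorSum-zero {n = suc n} {f} f≡0 = trans (cong (_xor xorSum (f ∘ suc)) (f≡0 zero)) (xorSum-zero (f≡0 ∘ suc))

xorSum-triple : {a b c : Fin n} (f : Fin n → Bool) → a ≢ b → a ≢ c → b ≢ c →
                (∀ j → j ≢ a → j ≢ b → j ≢ c → f j ≡ false) →
                xorSum f ≡ f a xor f b xor f c
xorSum-triple {a = a} {b} {c} f a≢b a≢c b≢c outside = begin
  xorSum f                                       ≡⟨ xorSum-erase a f ⟩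
  f a xor xorSum f₁                              ≡⟨ cong (f a xor_) (xorSum-erase b f₁) ⟩
  f a xor f₁ b xor xorSum f₂                     ≡⟨ cong (λ s → f a xor f₁ b xor s) (xorSum-erase c f₂) ⟩
  f a xor f₁ b xor f₂ c xor xorSum f₃            ≡⟨ cong (λ s → f a xor f₁ b xor f₂ c xor s) (xorSum-zero f₃≡0) ⟩
  f a xor f₁ b xor f₂ c xor false                ≡⟨ cong₂ (λ x y → f a xor x xor y) f₁b f₂c ⟩
  f a xor f b xor f c ∎
  where
  open ≡-Reasoning
  f₁ f₂ f₃ : Fin _ → Bool
  f₁ = erase a f
  f₂ = erase b f₁
  f₃ = erase c f₂
  f₁b : f₁ b ≡ f b
  f₁b = erase-≢ f (a≢b ∘ sym)
  f₂c : f₂ c xor false ≡ f c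
  f₂c = trans (xor-identityʳ _) (trans (erase-≢ f₁ (b≢c ∘ sym)) (erase-≢ f (a≢c ∘ sym)))
  f₃≡0 : ∀ j → f₃ j ≡ false
  f₃≡0 j with j ≟ c | j ≟ b | j ≟ a
  ... | yes _    | _        | _        = refl
  ... | no _     | yes _    | _        = refl
  ... | no _     | no _     | yes _    = refl
  ... | no j≢c   | no j≢b   | no j≢a   = outside j j≢a j≢b j≢c

triple : Fin n → Fin n → Fin n → Subset n
triple a b c j = does (j ≟ a) ∨ does (j ≟ b) ∨ does (j ≟ c)

triple-sound : {a b c j : Fin n} → triple a b c j ≡ true → j ≡ a ⊎ j ≡ b ⊎ j ≡ c
triple-sound {a = a} {b} {c} {j} j∈ with j ≟ a | j ≟ b | j ≟ c
... | yes j≡a | _        | _        = inj₁ j≡a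
... | no _    | yes j≡b  | _        = inj₂ (inj₁ j≡b)
... | no _    | no _     | yes j≡c  = inj₂ (inj₂ j≡c)
... | no _    | no _     | no _     = contradiction j∈ λ ()

triple-complete : {a b c j : Fin n} → j ≡ a ⊎ j ≡ b ⊎ j ≡ c → triple a b c j ≡ true
triple-complete {b = b} {c} {j} (inj₁ refl) = cong (_∨ does (j ≟ b) ∨ does (j ≟ c)) (dec-true (j ≟ j) refl)
triple-complete {a = a} {c = c} {j} (inj₂ (inj₁ refl)) =
  trans (cong (λ d → does (j ≟ a) ∨ d ∨ does (j ≟ c)) (dec-true (j ≟ j) refl)) (∨-zeroʳ (does (j ≟ a)))
triple-complete {a = a} {b} {j = j} (inj₂ (inj₂ refl)) =
  trans (cong (λ d → does (j ≟ a) ∨ does (j ≟ b) ∨ d) (dec-true (j ≟ j) refl))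
        (trans (cong (does (j ≟ a) ∨_) (∨-zeroʳ (does (j ≟ b)))) (∨-zeroʳ (does (j ≟ a))))

triple-outside : {a b c j : Fin n} → j ≢ a → j ≢ b → j ≢ c → triple a b c j ≡ false
triple-outside {a = a} {b} {c} {j} j≢a j≢b j≢c
  rewrite dec-false (j ≟ a) j≢a | dec-false (j ≟ b) j≢b | dec-false (j ≟ c) j≢c = refl

triple-swap : {a b c : Fin n} → triple a b c ≗ triple b a c
triple-swap {a = a} {b} {c} j = Or.x∙yz≈y∙xz (does (j ≟ a)) (does (j ≟ b)) (does (j ≟ c))

triple-rotate : {a b c : Fin n} → triple a b c ≗ triple c a b
triple-rotate {a = a} {b} {c} j = Or.x∙yz≈z∙xy (does (j ≟ a)) (does (j ≟ b)) (does (j ≟ c))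

triple-map : {n′ : ℕ} (f : Fin n → Fin n′) {a b c j : Fin n} →
             triple a b c j ≡ true → triple (f a) (f b) (f c) (f j) ≡ true
triple-map f j∈ with triple-sound j∈
... | inj₁ j≡a        = triple-complete (inj₁ (cong f j≡a))
... | inj₂ (inj₁ j≡b) = triple-complete (inj₂ (inj₁ (cong f j≡b)))
... | inj₂ (inj₂ j≡c) = triple-complete (inj₂ (inj₂ (cong f j≡c)))

indep-⊆ : {A : Matrix m n} {S T : Subset n} →
          (∀ j → T j ≡ true → S j ≡ true) → Indep A S → Indep A T
indep-⊆ T⊆S indep U U⊆T = indep U (λ j → T⊆S j ∘ U⊆T j)

indep-triple : {A : Matrix m n} {a b c : Fin n} → a ≢ b → a ≢ c → b ≢ c →
               LinIndep₃ (column A a) (column A b) (column A c) → Indep A (triple a b c)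
indep-triple {A = A} {a} {b} {c} a≢b a≢c b≢c indep T T⊆ (j , Tj) sums≡0
  = contradiction (trans (sym (proj₂ hit)) (trans (sym (sum-at (proj₁ hit))) (sums≡0 (proj₁ hit)))) λ ()
  where
  T-meets : j ≡ a ⊎ j ≡ b ⊎ j ≡ c → T a ∨ T b ∨ T c ≡ true
  T-meets (inj₁ refl)        = cong (_∨ T b ∨ T c) Tj
  T-meets (inj₂ (inj₁ refl)) = trans (cong (λ x → T a ∨ x ∨ T c) Tj) (∨-zeroʳ (T a))
  T-meets (inj₂ (inj₂ refl)) =
    trans (cong (λ x → T a ∨ T b ∨ x) Tj) (trans (cong (T a ∨_) (∨-zeroʳ (T b))) (∨-zeroʳ (T a)))
  T-outside : ∀ k → k ≢ a → k ≢ b → k ≢ c → T k ≡ false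
  T-outside k k≢a k≢b k≢c = ¬-not λ Tk → contradiction (T⊆ k Tk) (λ k∈ →
    contradiction (trans (sym k∈) (triple-outside k≢a k≢b k≢c)) λ ())
  hit : Nonzero (T a · column A a ⊕ T b · column A b ⊕ T c · column A c)
  hit = indep (T a) (T b) (T c) (T-meets (triple-sound (T⊆ j Tj)))
  sum-at : ∀ i → xorSum (λ k → T k ∧ A i k) ≡ (T a ∧ A i a) xor (T b ∧ A i b) xor (T c ∧ A i c)
  sum-at i = xorSum-triple _ a≢b a≢c b≢c λ k k≢a k≢b k≢c → cong (_∧ A i k) (T-outside k k≢a k≢b k≢c)

dependent-triple : {A : Matrix m n} {a b c : Fin n} → a ≢ b → a ≢ c → b ≢ c →
                   (∀ i → A i a xor A i b xor A i c ≡ false) → ¬ Indep A (triple a b c)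
dependent-triple {A = A} {a} {b} {c} a≢b a≢c b≢c sum≡0 indep =
  indep S (λ _ → id) (a , ∈S (inj₁ refl)) λ i → begin
    xorSum (λ j → S j ∧ A i j)
      ≡⟨ xorSum-triple _ a≢b a≢c b≢c (λ j j≢a j≢b j≢c → cong (_∧ A i j) (triple-outside j≢a j≢b j≢c)) ⟩
    (S a ∧ A i a) xor (S b ∧ A i b) xor (S c ∧ A i c)
      ≡⟨ cong₂ _xor_ (cong (_∧ A i a) (∈S (inj₁ refl)))
                     (cong₂ _xor_ (cong (_∧ A i b) (∈S (inj₂ (inj₁ refl)))) (cong (_∧ A i c) (∈S (inj₂ (inj₂ refl))))) ⟩
    A i a xor A i b xor A i c
      ≡⟨ sum≡0 i ⟩
    false ∎
  where
  open ≡-Reasoning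
  S : Subset _
  S = triple a b c
  ∈S : {j : Fin _} → j ≡ a ⊎ j ≡ b ⊎ j ≡ c → S j ≡ true
  ∈S = triple-complete

module Isomorphism {A : Matrix m n} {B : Matrix k r} (iso : Isomorphic A B) where

  open Inverse (Bijection⇒Inverse (proj₁ iso)) using (to; from; strictlyInverseˡ; strictlyInverseʳ)

  preimage : Fin r → Fin n
  preimage = from

  preimage-injective : Injective _≡_ _≡_ preimage
  preimage-injective {x} {y} same =
    trans (sym (strictlyInverseˡ x)) (trans (cong to same) (strictlyInverseˡ y))

  preimage-onto : (x : Fin n) → ∃ λ y → preimage y ≡ x
  preimage-onto x = to x , strictlyInverseʳ x

  reflects-dependence : {a b c : Fin r} →
    ¬ Indep B (triple a b c) → ¬ Indep A (triple (preimage a) (preimage b) (preimage c))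
  reflects-dependence {a} {b} {c} dependent indep =
    dependent (Equivalence.from (proj₂ iso (triple a b c)) (indep-⊆ pulled-back indep))
    where
    pulled-back : ∀ j → triple a b c (to j) ≡ true → triple (from a) (from b) (from c) j ≡ true
    pulled-back j to-j∈ = subst (λ x → triple (from a) (from b) (from c) x ≡ true) (strictlyInverseʳ j)
                                (triple-map from to-j∈)

missed-by : k < r → (xs : Fin k → Fin r) → ∃ λ m → ∀ i → xs i ≢ m
missed-by {k} {r} k<r xs with ¬∀⟶∃¬ r (λ m → ∃ λ i → xs i ≡ m) (λ m → any? (λ i → xs i ≟ m)) not-onto
  where
  not-onto : ¬ (∀ m → ∃ λ i → xs i ≡ m)
  not-onto onto = <⇒≱ k<r (injective⇒≤ {f = proj₁ ∘ onto} λ {m} {m′} same →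
    trans (sym (proj₂ (onto m))) (trans (cong xs same) (proj₂ (onto m′))))
... | m , m∉ = m , λ i xsᵢ≡m → m∉ (i , xsᵢ≡m)

distinct-pair : 1 < k → ∃₂ λ (i j : Fin k) → i ≢ j
distinct-pair (s≤s (s≤s _)) = zero , suc zero , λ ()

two-others : 2 < k → (i : Fin k) → ∃₂ λ j j′ → i ≢ j × i ≢ j′ × j ≢ j′
two-others k>2 i =
  let j  , j∉  = missed-by (<⇒≤ k>2) (i ∷ [])
      j′ , j′∉ = missed-by k>2 (i ∷ j ∷ [])
  in j , j′ , j∉ zero , j′∉ zero , j′∉ (suc zero)

↑ˡ≢↑ʳ : (i : Fin m) (j : Fin n) → i ↑ˡ n ≢ m ↑ʳ j
↑ˡ≢↑ʳ {m} {n} i j eq =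
  contradiction (trans (sym (splitAt-↑ˡ m i n)) (trans (cong (splitAt m) eq) (splitAt-↑ʳ m n j))) λ ()

unit : Fin r → Fin r → Bool
unit a i = ⌊ a ≟ i ⌋

unit-self : (a : Fin r) → unit a a ≡ true
unit-self a = trans (isYes≗does (a ≟ a)) (dec-true (a ≟ a) refl)

unit-≢ : {a i : Fin r} → a ≢ i → unit a i ≡ false
unit-≢ {a = a} {i} a≢i = trans (isYes≗does (a ≟ i)) (dec-false (a ≟ i) a≢i)

-- x_a is leg false a and y_a is leg true a: the Bool records whether the column is complemented.
leg : Bool → Fin r → Fin (r + r + 1)
leg {r} false a = (a ↑ˡ r) ↑ˡ 1
leg {r} true  a = (r ↑ʳ a) ↑ˡ 1

Z-leg : ∀ f (a i : Fin r) → Z r i (leg f a) ≡ f xor unit a i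
Z-leg {r} false a i rewrite splitAt-↑ˡ (r + r) (a ↑ˡ r) 1 | splitAt-↑ˡ r a r = refl
Z-leg {r} true  a i rewrite splitAt-↑ˡ (r + r) (r ↑ʳ a) 1 | splitAt-↑ʳ r r a = refl

Z-tip : (i : Fin r) → Z r i (tip r) ≡ true
Z-tip {r} i rewrite splitAt-↑ʳ (r + r) 1 zero = refl

leg-injective : ∀ {f g} {a b : Fin r} → leg f a ≡ leg g b → f ≡ g × a ≡ b
leg-injective {r} {false} {false} eq = refl , ↑ˡ-injective r _ _ (↑ˡ-injective 1 _ _ eq)
leg-injective {r} {true}  {true}  eq = refl , ↑ʳ-injective r _ _ (↑ˡ-injective 1 _ _ eq)
leg-injective {r} {false} {true} {a} {b} eq = contradiction (↑ˡ-injective 1 _ _ eq) (↑ˡ≢↑ʳ a b)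
leg-injective {r} {true} {false} {a} {b} eq = contradiction (sym (↑ˡ-injective 1 _ _ eq)) (↑ˡ≢↑ʳ b a)

leg≢leg-not : ∀ f (a : Fin r) → leg f a ≢ leg (not f) a
leg≢leg-not {r} f a = not-¬ refl ∘ proj₁ ∘ leg-injective {r} {f} {not f}

leg≢tip : ∀ f (a : Fin r) → leg f a ≢ tip r
leg≢tip {r} false a = ↑ˡ≢↑ʳ (a ↑ˡ r) zero
leg≢tip {r} true  a = ↑ˡ≢↑ʳ (r ↑ʳ a) zero

data SpikeView (r : ℕ) : Fin (r + r + 1) → Set where
  tipᵛ : SpikeView r (tip r)
  legᵛ : ∀ f (a : Fin r) → SpikeView r (leg f a)

spikeView : ∀ r (j : Fin (r + r + 1)) → SpikeView r j
spikeView r j with splitAt (r + r) j in eq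
... | inj₂ zero = subst (SpikeView r) (splitAt⁻¹-↑ʳ eq) tipᵛ
... | inj₁ k with splitAt r k in eq′
...   | inj₁ a = subst (SpikeView r) (trans (cong (_↑ˡ 1) (splitAt⁻¹-↑ˡ eq′)) (splitAt⁻¹-↑ˡ eq)) (legᵛ false a)
...   | inj₂ b = subst (SpikeView r) (trans (cong (_↑ˡ 1) (splitAt⁻¹-↑ʳ eq′)) (splitAt⁻¹-↑ˡ eq)) (legᵛ true b)

record IsSimple (A : Matrix m n) : Set where
  field
    column-nonzero : ∀ j → Nonzero (column A j)
    columns-differ : ∀ {j k} → j ≢ k → Nonzero (column A j ⊕ column A k)

flipped-unit-nonzero : 2 ≤ r → ∀ f (a : Fin r) → Nonzero (λ i → f xor unit a i)
flipped-unit-nonzero r≥2 f a with m , m∉ ← missed-by r≥2 (a ∷ []) =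
  nonzero-flip f (a , unit-self a) (m , unit-≢ (m∉ zero))

three-units-nonzero : (a b c : Fin r) → Nonzero (λ i → unit a i xor unit b i xor unit c i)
three-units-nonzero a b c with a ≟ b | a ≟ c
... | yes refl | _ = c , (begin
  unit a c xor unit a c xor unit c c ≡⟨ cong (λ u → unit a c xor unit a c xor u) (unit-self c) ⟩
  unit a c xor unit a c xor true     ≡⟨ sym (xor-assoc (unit a c) _ true) ⟩
  (unit a c xor unit a c) xor true   ≡⟨ cong (_xor true) (xor-same (unit a c)) ⟩
  true                               ∎)
  where open ≡-Reasoning
... | no a≢b | yes refl = b , cong₂ (λ x y → x xor y xor x) (unit-≢ a≢b) (unit-self b)
... | no a≢b | no a≢c = a , cong₂ (λ x y → x xor y) (unit-self a)
                               (cong₂ _xor_ (unit-≢ (a≢b ∘ sym)) (unit-≢ (a≢c ∘ sym)))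

Z-leg-pair : ∀ f g (a b i : Fin r) →
             Z r i (leg f a) xor Z r i (leg g b) ≡ (f xor g) xor (unit a i xor unit b i)
Z-leg-pair f g a b i = trans (cong₂ _xor_ (Z-leg f a i) (Z-leg g b i)) (Xor.interchange f _ g _)

Z-leg-triple : ∀ f g h (a b c i : Fin r) →
               Z r i (leg f a) xor Z r i (leg g b) xor Z r i (leg h c) ≡
               (f xor g xor h) xor (unit a i xor unit b i xor unit c i)
Z-leg-triple f g h a b c i = begin
  Z _ i (leg f a) xor Z _ i (leg g b) xor Z _ i (leg h c)
    ≡⟨ cong₂ _xor_ (Z-leg f a i) (Z-leg-pair g h b c i) ⟩
  (f xor unit a i) xor (g xor h) xor (unit b i xor unit c i)
    ≡⟨ Xor.interchange f _ (g xor h) _ ⟩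
  (f xor g xor h) xor (unit a i xor unit b i xor unit c i) ∎
  where open ≡-Reasoning

Z-column-nonzero : 2 ≤ r → (j : Fin (r + r + 1)) → Nonzero (column (Z r) j)
Z-column-nonzero {r = suc r} r≥2@(s≤s _) j with spikeView (suc r) j
... | tipᵛ     = zero , Z-tip {suc r} zero
... | legᵛ f a = nonzero-cong (λ i → sym (Z-leg f a i)) (flipped-unit-nonzero r≥2 f a)

Z-columns-differ : 3 ≤ r → {j k : Fin (r + r + 1)} → j ≢ k →
                   Nonzero (column (Z r) j ⊕ column (Z r) k)
Z-columns-differ {r} r≥3 {j} {k} j≢k with spikeView r j | spikeView r k
... | tipᵛ | tipᵛ = contradiction refl j≢k
... | tipᵛ | legᵛ g b = nonzero-cong
  (λ i → sym (trans (cong₂ _xor_ (Z-tip i) (Z-leg g b i)) (not-distribˡ-xor g (unit b i))))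
  (flipped-unit-nonzero (<⇒≤ r≥3) (not g) b)
... | legᵛ f a | tipᵛ = nonzero-cong
  (λ i → sym (trans (cong₂ _xor_ (Z-leg f a i) (Z-tip i))
                    (trans (xor-comm (f xor unit a i) true) (not-distribˡ-xor f (unit a i)))))
  (flipped-unit-nonzero (<⇒≤ r≥3) (not f) a)
... | legᵛ f a | legᵛ g b with a ≟ b
...   | yes refl = a , (begin
  Z _ a (leg f a) xor Z _ a (leg g a) ≡⟨ Z-leg-pair f g a a a ⟩
  (f xor g) xor (unit a a xor unit a a) ≡⟨ cong ((f xor g) xor_) (xor-same (unit a a)) ⟩
  (f xor g) xor false                 ≡⟨ xor-identityʳ (f xor g) ⟩
  f xor g                             ≡⟨ cong (_xor g) (¬-not {f} {g} λ f≡g → j≢k (cong (λ x → leg {r} x a) f≡g)) ⟩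
  not g xor g                         ≡⟨ xor-inverseˡ g ⟩
  true                                ∎)
  where open ≡-Reasoning
...   | no a≢b with m , m∉ ← missed-by r≥3 (a ∷ b ∷ []) = nonzero-cong
  (λ i → sym (Z-leg-pair f g a b i))
  (nonzero-flip (f xor g) (a , cong₂ _xor_ (unit-self a) (unit-≢ (a≢b ∘ sym)))
                          (m , cong₂ _xor_ (unit-≢ (m∉ zero)) (unit-≢ (m∉ (suc zero)))))

-- Off the rows a, b, c the sum is the constant f + g + h; on them the three unit vectors,
-- an odd number, cannot cancel.
Z-nontip-sum : 4 ≤ r → {j k l : Fin (r + r + 1)} → j ≢ tip r → k ≢ tip r → l ≢ tip r →
               Nonzero (column (Z r) j ⊕ column (Z r) k ⊕ column (Z r) l)
Z-nontip-sum {r} r≥4 {j} {k} {l} j≢t k≢t l≢t with spikeView r j | spikeView r k | spikeView r l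
... | tipᵛ | _ | _ = contradiction refl j≢t
... | _ | tipᵛ | _ = contradiction refl k≢t
... | _ | _ | tipᵛ = contradiction refl l≢t
... | legᵛ f a | legᵛ g b | legᵛ h c with m , m∉ ← missed-by r≥4 (a ∷ b ∷ c ∷ []) = nonzero-cong
  (λ i → sym (Z-leg-triple f g h a b c i))
  (nonzero-flip (f xor g xor h) (three-units-nonzero a b c)
    (m , cong₂ _xor_ (unit-≢ (m∉ zero)) (cong₂ _xor_ (unit-≢ (m∉ (suc zero))) (unit-≢ (m∉ (suc (suc zero)))))))

Z-isSimple : 3 ≤ r → IsSimple (Z r)
Z-isSimple r≥3 = record
  { column-nonzero = Z-column-nonzero (<⇒≤ r≥3)
  ; columns-differ = Z-columns-differ r≥3
  }

Z-nontip-linIndep₃ : 4 ≤ r → {j k l : Fin (r + r + 1)} → j ≢ k → j ≢ l → k ≢ l →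
                     j ≢ tip r → k ≢ tip r → l ≢ tip r →
                     LinIndep₃ (column (Z r) j) (column (Z r) k) (column (Z r) l)
Z-nontip-linIndep₃ r≥4 {j} {k} {l} j≢k j≢l k≢l j≢t k≢t l≢t =
  linIndep₃ (column-nonzero j) (column-nonzero k) (column-nonzero l)
            (columns-differ j≢k) (columns-differ j≢l) (columns-differ k≢l)
            (Z-nontip-sum r≥4 j≢t k≢t l≢t)
  where open IsSimple (Z-isSimple (<⇒≤ r≥4))

Z-leg-dependent : (i : Fin r) → ¬ Indep (Z r) (triple (tip r) (leg false i) (leg true i))
Z-leg-dependent i = dependent-triple (leg≢tip false i ∘ sym) (leg≢tip true i ∘ sym)
  (leg≢leg-not false i)
  λ row → trans (cong₂ _xor_ (Z-tip row) (cong₂ _xor_ (Z-leg false i row) (Z-leg true i row)))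
                (cong not (xor-inverseʳ (unit i row)))

module Split {m n : ℕ} (A : Matrix m n) (X : Subset n) (e : Fin n) where

  M : Matrix (m + 1) (n + 2)
  M = split A X e

  ι : Fin n → Fin (n + 2)
  ι j = j ↑ˡ 2

  α γ : Fin (n + 2)
  α = n ↑ʳ zero
  γ = n ↑ʳ suc zero

  top : Fin (n + 2) → Fin m → Bool
  top z i = M (i ↑ˡ 1) z

  top-ι : ∀ j → top (ι j) ≗ column A j
  top-ι j i rewrite splitAt-↑ˡ m i 1 | splitAt-↑ˡ n j 2 = refl

  top-γ : top γ ≗ column A e
  top-γ i rewrite splitAt-↑ˡ m i 1 | splitAt-↑ʳ n 2 (suc zero) = refl

  top-α : ∀ i → top α i ≡ false
  top-α i rewrite splitAt-↑ˡ m i 1 | splitAt-↑ʳ n 2 zero = refl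

  α-bottom : M (m ↑ʳ zero) α ≡ true
  α-bottom rewrite splitAt-↑ʳ m 1 zero | splitAt-↑ʳ n 2 zero = refl

  ι-injective : ∀ {j k} → ι j ≡ ι k → j ≡ k
  ι-injective = ↑ˡ-injective 2 _ _

  data SplitView : Fin (n + 2) → Set where
    ιᵛ : ∀ j → SplitView (ι j)
    αᵛ : SplitView α
    γᵛ : SplitView γ

  splitView : ∀ z → SplitView z
  splitView z with splitAt n z in eq
  ... | inj₁ j          = subst SplitView (splitAt⁻¹-↑ˡ eq) (ιᵛ j)
  ... | inj₂ zero       = subst SplitView (splitAt⁻¹-↑ʳ eq) αᵛ
  ... | inj₂ (suc zero) = subst SplitView (splitAt⁻¹-↑ʳ eq) γᵛ

  -- α, ι e and γ = α + ι e are the three points of the line of M through α and ι e.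
  αLine : Fin (n + 2) → Set
  αLine z = z ≡ γ ⊎ z ≡ ι e

  αLine-cover : ∀ {a b z} → αLine a → αLine b → a ≢ b → αLine z → z ≡ a ⊎ z ≡ b
  αLine-cover (inj₁ refl) (inj₁ refl) a≢b _           = contradiction refl a≢b
  αLine-cover (inj₂ refl) (inj₂ refl) a≢b _           = contradiction refl a≢b
  αLine-cover (inj₁ refl) (inj₂ refl) _   (inj₁ refl) = inj₁ refl
  αLine-cover (inj₁ refl) (inj₂ refl) _   (inj₂ refl) = inj₂ refl
  αLine-cover (inj₂ refl) (inj₁ refl) _   (inj₁ refl) = inj₂ refl
  αLine-cover (inj₂ refl) (inj₁ refl) _   (inj₂ refl) = inj₁ refl

  indep-through-α : IsSimple A → ∀ {a b j k} → α ≢ a → α ≢ b → a ≢ b →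
                    top a ≗ column A j → top b ≗ column A k → j ≢ k → Indep M (triple α a b)
  indep-through-α simple α≢a α≢b a≢b top-a top-b j≢k = indep-triple α≢a α≢b a≢b
    (linIndep₃-adjoin (_↑ˡ 1) top-α (m ↑ʳ zero , α-bottom)
      (nonzero-cong (sym ∘ top-a) (column-nonzero _))
      (nonzero-cong (sym ∘ top-b) (column-nonzero _))
      (nonzero-cong (λ i → sym (cong₂ _xor_ (top-a i) (top-b i))) (columns-differ j≢k)))
    where open IsSimple simple

  dependent-through-α : IsSimple A → ∀ {a b} → α ≢ a → α ≢ b → a ≢ b →
                        ¬ Indep M (triple α a b) → αLine a × αLine b
  dependent-through-α simple {a} {b} α≢a α≢b a≢b dependent with splitView a | splitView b
  ... | αᵛ   | _    = contradiction refl α≢a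
  ... | _    | αᵛ   = contradiction refl α≢b
  ... | γᵛ   | γᵛ   = contradiction refl a≢b
  ... | ιᵛ j | ιᵛ k =
    contradiction (indep-through-α simple α≢a α≢b a≢b (top-ι j) (top-ι k) (a≢b ∘ cong ι)) dependent
  ... | ιᵛ j | γᵛ with j ≟ e
  ...   | yes refl = inj₂ refl , inj₁ refl
  ...   | no j≢e   = contradiction (indep-through-α simple α≢a α≢b a≢b (top-ι j) top-γ j≢e) dependent
  dependent-through-α simple α≢a α≢b a≢b dependent | γᵛ | ιᵛ k with k ≟ e
  ...   | yes refl = inj₁ refl , inj₂ refl
  ...   | no k≢e   = contradiction (indep-through-α simple α≢a α≢b a≢b top-γ (top-ι k) (k≢e ∘ sym)) dependent

  indep-on-αLine : ∀ {p j k} → αLine p → j ≢ e → k ≢ e → j ≢ k →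
                   LinIndep₃ (column A e) (column A j) (column A k) → Indep M (triple p (ι j) (ι k))
  indep-on-αLine {p} {j} {k} p∈ j≢e k≢e j≢k indep =
    indep-triple (p≢ι p∈ j≢e) (p≢ι p∈ k≢e) (j≢k ∘ ι-injective)
      (linIndep₃-restrict (_↑ˡ 1) (linIndep₃-cong (sym ∘ top-p p∈) (sym ∘ top-ι j) (sym ∘ top-ι k) indep))
    where
    p≢ι : ∀ {l} → αLine p → l ≢ e → p ≢ ι l
    p≢ι {l} (inj₁ refl) _   = ↑ˡ≢↑ʳ l (suc zero) ∘ sym
    p≢ι     (inj₂ refl) l≢e = l≢e ∘ sym ∘ ι-injective
    top-p : αLine p → top p ≗ column A e
    top-p (inj₁ refl) = top-γ
    top-p (inj₂ refl) = top-ι e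

module SplitSpike {r : ℕ} (r≥4 : 4 ≤ r) (X : Subset (r + r + 1)) (e : Fin (r + r + 1)) (e≢tip : e ≢ tip r) where

  open Split (Z r) X e public

  dependent-through-αLine : ∀ {p a b} → αLine p → α ≢ a → α ≢ b → ¬ αLine a → ¬ αLine b → a ≢ b →
                            ¬ Indep M (triple p a b) → a ≡ ι (tip r) ⊎ b ≡ ι (tip r)
  dependent-through-αLine {p} {a} {b} p∈ α≢a α≢b a∉ b∉ a≢b dependent with splitView a | splitView b
  ... | αᵛ | _  = contradiction refl α≢a
  ... | _  | αᵛ = contradiction refl α≢b
  ... | γᵛ | _  = contradiction (inj₁ refl) a∉
  ... | _  | γᵛ = contradiction (inj₁ refl) b∉
  ... | ιᵛ j | ιᵛ k with j ≟ tip r | k ≟ tip r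
  ...   | yes j≡t | _       = inj₁ (cong ι j≡t)
  ...   | no _    | yes k≡t = inj₂ (cong ι k≡t)
  ...   | no j≢t  | no k≢t  = contradiction
    (indep-on-αLine p∈ (a∉ ∘ inj₂ ∘ cong ι) (b∉ ∘ inj₂ ∘ cong ι) (a≢b ∘ cong ι)
      (Z-nontip-linIndep₃ r≥4 (a∉ ∘ inj₂ ∘ cong ι ∘ sym) (b∉ ∘ inj₂ ∘ cong ι ∘ sym) (a≢b ∘ cong ι)
                          e≢tip j≢t k≢t))
    dependent

  module _ {k : ℕ} (ψ : Fin (k + k + 1) → Fin (r + r + 1 + 2)) (ψ-injective : Injective _≡_ _≡_ ψ)
           (legs : ∀ (i : Fin k) → ¬ Indep M (triple (ψ (tip k)) (ψ (leg false i)) (ψ (leg true i)))) where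

    private
      ψ-≢ : ∀ {s s′} → s ≢ s′ → ψ s ≢ ψ s′
      ψ-≢ s≢s′ = s≢s′ ∘ ψ-injective

      legs-≢ : ∀ f g {i j : Fin k} → i ≢ j → leg f i ≢ leg g j
      legs-≢ f g i≢j = i≢j ∘ proj₂ ∘ leg-injective {k} {f} {g}

      tip≢leg : ∀ f (i : Fin k) → tip k ≢ leg f i
      tip≢leg f i = leg≢tip f i ∘ sym

    leg-dependent : ∀ f (i : Fin k) → ¬ Indep M (triple (ψ (leg f i)) (ψ (tip k)) (ψ (leg (not f) i)))
    leg-dependent false i = legs i ∘ indep-⊆ λ j → trans (sym (triple-swap {a = ψ (tip k)} j))
    leg-dependent true  i = legs i ∘ indep-⊆ λ j → trans (sym (triple-rotate {a = ψ (tip k)} j))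

    tip-misses-α : {i j : Fin k} → i ≢ j → ψ (tip k) ≢ α
    tip-misses-α {i} {j} i≢j ψt≡α =
      [ ψ-≢ (legs-≢ false false (i≢j ∘ sym)) , ψ-≢ (legs-≢ false true (i≢j ∘ sym)) ]′
        (αLine-cover (proj₁ (on-line i)) (proj₂ (on-line i)) (ψ-≢ (leg≢leg-not false i)) (proj₁ (on-line j)))
      where
      α≢leg : ∀ f l → α ≢ ψ (leg f l)
      α≢leg f l α≡ψ = ψ-≢ (tip≢leg f l) (trans ψt≡α α≡ψ)
      on-line : ∀ l → αLine (ψ (leg false l)) × αLine (ψ (leg true l))
      on-line l = dependent-through-α (Z-isSimple (<⇒≤ r≥4)) (α≢leg false l) (α≢leg true l)
        (ψ-≢ (leg≢leg-not false l)) (subst (λ p → ¬ Indep M (triple p _ _)) ψt≡α (legs l))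

    leg-misses-α : ∀ f (i : Fin k) {j j′} → i ≢ j → i ≢ j′ → j ≢ j′ → ψ (leg f i) ≢ α
    leg-misses-α f i i≢j i≢j′ j≢j′ ψfi≡α =
      let g  , ψ-on-tip  = through-tip i≢j
          g′ , ψ-on-tip′ = through-tip i≢j′
      in legs-≢ g g′ j≢j′ (ψ-injective (trans ψ-on-tip (sym ψ-on-tip′)))
      where
      p q : Fin (r + r + 1 + 2)
      p = ψ (tip k)
      q = ψ (leg (not f) i)
      α≢ : ∀ s → s ≢ leg f i → α ≢ ψ s
      α≢ s s≢ α≡ψs = ψ-≢ s≢ (sym (trans ψfi≡α α≡ψs))
      line : αLine p × αLine q
      line = dependent-through-α (Z-isSimple (<⇒≤ r≥4))
        (α≢ (tip k) (tip≢leg f i)) (α≢ (leg (not f) i) (leg≢leg-not f i ∘ sym))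
        (ψ-≢ (tip≢leg (not f) i)) (subst (λ z → ¬ Indep M (triple z p q)) ψfi≡α (leg-dependent f i))
      off-line : ∀ s → s ≢ tip k → s ≢ leg (not f) i → ¬ αLine (ψ s)
      off-line s s≢t s≢q s∈ =
        [ ψ-≢ s≢t , ψ-≢ s≢q ]′ (αLine-cover (proj₁ line) (proj₂ line) (ψ-≢ (tip≢leg (not f) i)) s∈)
      through-tip : ∀ {l} → i ≢ l → ∃ λ g → ψ (leg g l) ≡ ι (tip r)
      through-tip {l} i≢l = [ (false ,_) , (true ,_) ]′ (dependent-through-αLine (proj₁ line)
        (α≢ (leg false l) (legs-≢ false f (i≢l ∘ sym))) (α≢ (leg true l) (legs-≢ true f (i≢l ∘ sym)))
        (off-line (leg false l) (leg≢tip false l) (legs-≢ false (not f) (i≢l ∘ sym)))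
        (off-line (leg true l) (leg≢tip true l) (legs-≢ true (not f) (i≢l ∘ sym)))
        (ψ-≢ (leg≢leg-not false l)) (legs l))

    spike-misses-α : 3 ≤ k → ∀ s → ψ s ≢ α
    spike-misses-α k≥3 s with spikeView k s
    ... | tipᵛ = let _ , _ , i≢j = distinct-pair (<⇒≤ k≥3) in tip-misses-α i≢j
    ... | legᵛ f i = let _ , _ , i≢j , i≢j′ , j≢j′ = two-others k≥3 i in leg-misses-α f i i≢j i≢j′ j≢j′

lemma6 : (r : ℕ) → 4 ≤ r → (X : Subset (r + r + 1)) → X (tip r) ≡ false →
         (e : Fin (r + r + 1)) → X e ≡ true →
         ¬ Isomorphic (split (Z r) X e) (Z (suc r))
lemma6 r r≥4 X X-tip e Xe iso =
  uncurry (spike-misses-α preimage preimage-injective legs (m≤n⇒m≤1+n (<⇒≤ r≥4))) (preimage-onto α)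
  where
  e≢tip : e ≢ tip r
  e≢tip e≡t = contradiction (trans (sym Xe) (trans (cong X e≡t) X-tip)) λ ()
  open SplitSpike r≥4 X e e≢tip
  open Isomorphism {A = M} {B = Z (suc r)} iso
  legs : ∀ i → ¬ Indep M (triple (preimage (tip (suc r))) (preimage (leg false i)) (preimage (leg true i)))
  legs i = reflects-dependence (Z-leg-dependent i)
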